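{- $\textsc{Lossy-Code}\cap\textsc{Sink-Of-Metered-Line}$ reduces to $\textsc{Empty-Child-w-Height}$ by a black-box ($\le_{dt}$) reduction.
   Context: Query model with $\le_{dt}$ reductions (the target instance's input bits computed by decision trees over the source input, target solutions mapped back by decision trees, log target-input-length plus depth $\mathrm{polylog}$ in the source size). $\textsc{Lossy-Code}$: given $f:[N]\to[2N]$, $g:[2N]\to[N]$, find $x\in[2N]$ with $f(g(x))\neq x$. $\textsc{Sink-Of-Metered-Line}$: given $S,P:[M]\to[M]$ and $W:[M]\to[M]\cup\{0\}$, a solution is $1$ if $P(1)\ne1$ or $S(1)=1$ or $W(1)\ne1$; or $x$ with $P(S(x))\neq x$; or $x\ne1$ with $W(x)=1$; or $x$ with ($W(x)>0$ and $W(S(x))-W(x)\ne1$) or ($W(x)>1$ and $W(x)-W(P(x))\neq1$). $\textsc{Lossy-Code}\cap\textsc{Sink-Of-Metered-Line}$: the input is a $\textsc{Lossy-Code}$ instance together with a $\textsc{Sink-Of-Metered-Line}$ instance, and a solution is a solution to either. $\textsc{Empty-Child-w-Height}$: given $V=[K]$, $F,L,R:V\to V$, $H:V\to[K]$, a solution is (s1) $u$ with $F(L(u))\ne u$ or $F(R(u))\ne u$ or $L(u)=R(u)\ne u$; (s2) $1$ if $L(1)=1$ or $R(1)=1$ or $F(1)\ne1$; (s4) $u\ne1$ with $u\ne F(u)$ and $H(u)\ne H(F(u))+1$, or $1$ if $H(1)\ne1$. -}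

module Defs where

open import Data.Nat using (ℕ; zero; suc; _+_; _*_; _^_; _≤_; _<_)
open import Data.Nat.Logarithm using (⌈log₂_⌉)
open import Data.Fin using (Fin; toℕ)
open import Data.Product using (_×_; ∃)
open import Data.Sum using (_⊎_; inj₁; inj₂)
open import Relation.Binary.PropositionalEquality using (_≡_; _≢_)

data DT (Q : Set) (A : Q → Set) (O : Set) : Set where
  leaf : O → DT Q A O
  node : (q : Q) → (A q → DT Q A O) → DT Q A O

eval : {Q : Set} {A : Q → Set} {O : Set} → DT Q A O → ((q : Q) → A q) → O
eval (leaf o)   I = o
eval (node q k) I = eval (k (I q)) I

data DepthLE {Q : Set} {A : Q → Set} {O : Set} : DT Q A O → ℕ → Set where
  leaf≤ : ∀ {o d} → DepthLE (leaf o) d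
  node≤ : ∀ {q k d} → (∀ a → DepthLE (k a) d) → DepthLE (node q k) (suc d)

record SearchProblem : Set₁ where
  field
    Param : Set
    Query : Param → Set
    Ans   : (p : Param) → Query p → Set
    Out   : Param → Set
    Sol   : (p : Param) → ((q : Query p) → Ans p q) → Out p → Set
    size  : Param → ℕ                                -- input length (# symbols)

open SearchProblem public

record _≤dt_ (P R : SearchProblem) : Set where
  field
    tgt        : Param P → Param R
    depth      : Param P → ℕ
    inst       : (p : Param P) (q : Query R (tgt p)) →
                 DT (Query P p) (Ans P p) (Ans R (tgt p) q)
    inst-depth : ∀ p q → DepthLE (inst p q) (depth p)
    back       : (p : Param P) (o : Out R (tgt p)) →
                 DT (Query P p) (Ans P p) (Out P p)
    back-depth : ∀ p o → DepthLE (back p o) (depth p)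
    correct    : ∀ p (I : (q : Query P p) → Ans P p q) (o : Out R (tgt p)) →
                 Sol R (tgt p) (λ q → eval (inst p q) I) o →
                 Sol P p I (eval (back p o) I)
    polylog    : ∃ λ c → ∀ p →
                 ⌈log₂ size R (tgt p) ⌉ + depth p ≤ c * (suc ⌈log₂ size P p ⌉) ^ c

-- Concrete problems.  [N] is Fin N with the element i standing for
-- toℕ i + 1; in particular the distinguished element 1 is Fin.zero.

LossyCodeSol : (n : ℕ) → (Fin (suc n) → Fin (2 * suc n)) →
               (Fin (2 * suc n) → Fin (suc n)) → Fin (2 * suc n) → Set
LossyCodeSol n f g x = f (g x) ≢ x

-- Sink-Of-Metered-Line with M = suc m.  W : [M] → [M] ∪ {0} is encoded as
-- Fin (suc M) where toℕ gives the actual value (0..M).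
SOMLSol : (m : ℕ) → (S P : Fin (suc m) → Fin (suc m)) →
          (W : Fin (suc m) → Fin (suc (suc m))) → Fin (suc m) → Set
SOMLSol m S P W x =
    (x ≡ Fin.zero × (P Fin.zero ≢ Fin.zero ⊎ S Fin.zero ≡ Fin.zero ⊎ toℕ (W Fin.zero) ≢ 1))
  ⊎ P (S x) ≢ x
  ⊎ (x ≢ Fin.zero × toℕ (W x) ≡ 1)
  ⊎ ((0 < toℕ (W x) × toℕ (W (S x)) ≢ suc (toℕ (W x)))
     ⊎ (1 < toℕ (W x) × toℕ (W x) ≢ suc (toℕ (W (P x)))))

data LSQuery (n m : ℕ) : Set where
  qf : Fin (suc n) → LSQuery n m
  qg : Fin (2 * suc n) → LSQuery n m
  qS : Fin (suc m) → LSQuery n m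
  qP : Fin (suc m) → LSQuery n m
  qW : Fin (suc m) → LSQuery n m

LSAns : (nm : ℕ × ℕ) → LSQuery (Data.Product.proj₁ nm) (Data.Product.proj₂ nm) → Set
LSAns (n Data.Product., m) (qf _) = Fin (2 * suc n)
LSAns (n Data.Product., m) (qg _) = Fin (suc n)
LSAns (n Data.Product., m) (qS _) = Fin (suc m)
LSAns (n Data.Product., m) (qP _) = Fin (suc m)
LSAns (n Data.Product., m) (qW _) = Fin (suc (suc m))

LSSol : (nm : ℕ × ℕ) →
        ((q : LSQuery (Data.Product.proj₁ nm) (Data.Product.proj₂ nm)) → LSAns nm q) →
        Fin (2 * suc (Data.Product.proj₁ nm)) ⊎ Fin (suc (Data.Product.proj₂ nm)) → Set
LSSol (n Data.Product., m) I (inj₁ x) =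
  LossyCodeSol n (λ i → I (qf i)) (λ j → I (qg j)) x
LSSol (n Data.Product., m) I (inj₂ x) =
  SOMLSol m (λ i → I (qS i)) (λ i → I (qP i)) (λ i → I (qW i)) x

-- Lossy-Code ∩ Sink-Of-Metered-Line, parameters (n , m) meaning N = n+1, M = m+1.
LossyCode∩SOML : SearchProblem
LossyCode∩SOML = record
  { Param = ℕ × ℕ
  ; Query = λ nm → LSQuery (Data.Product.proj₁ nm) (Data.Product.proj₂ nm)
  ; Ans   = LSAns
  ; Out   = λ nm → Fin (2 * suc (Data.Product.proj₁ nm)) ⊎ Fin (suc (Data.Product.proj₂ nm))
  ; Sol   = LSSol
  ; size  = λ nm → 3 * suc (Data.Product.proj₁ nm) + 3 * suc (Data.Product.proj₂ nm)
  }

-- Empty-Child-w-Height with K = suc k.  H : V → [K] is Fin K with toℕ + 1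
-- giving the actual height, so H u = zero means height 1.
data ECQuery (k : ℕ) : Set where
  qF qL qR qH : Fin (suc k) → ECQuery k

ECHSol : (k : ℕ) → (F L R H : Fin (suc k) → Fin (suc k)) → Fin (suc k) → Set
ECHSol k F L R H u =
    (F (L u) ≢ u ⊎ F (R u) ≢ u ⊎ (L u ≡ R u × L u ≢ u))
  ⊎ (u ≡ Fin.zero × (L Fin.zero ≡ Fin.zero ⊎ R Fin.zero ≡ Fin.zero ⊎ F Fin.zero ≢ Fin.zero))
  ⊎ ((u ≢ Fin.zero × u ≢ F u × toℕ (H u) ≢ suc (toℕ (H (F u))))
     ⊎ (u ≡ Fin.zero × H Fin.zero ≢ Fin.zero))

EmptyChildWithHeight : SearchProblem
EmptyChildWithHeight = record
  { Param = ℕ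
  ; Query = ECQuery
  ; Ans   = λ k _ → Fin (suc k)
  ; Out   = λ k → Fin (suc k)
  ; Sol   = λ k I → ECHSol k (λ u → I (qF u)) (λ u → I (qL u)) (λ u → I (qR u)) (λ u → I (qH u))
  ; size  = λ k → 4 * suc k
  }

-- The tree lives on [M] × [N]: node (x , y) is slot y on layer x of the metered line.  Its root
-- is (1 , 1); the other tree nodes are those on layers x ≠ 1 with W x > 0, and all remaining
-- nodes are isolated self-loops.  A tree node (x , y) has the children (S x , g c) for the two
-- codewords c ∈ {y , N + y} of y, the parent (P x , f y mod N), and height W x.
-- If neither 1 nor x solves Sink-Of-Metered-Line and f (g c) = c for both codewords c of y, then
-- P (S x) = x, S x ≠ 1 and W grows by one along S, so both children of (x , y) are distinct and
-- have (x , y) as parent, and heights drop by one towards the root: (x , y) solves nothing.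
-- Checking these four candidates pulls a solution back with 9 + 9 + 2 + 2 queries, and the
-- target has 4MN input symbols, so its log-size is linear in that of the source.

module Submission where

open import Defs
open import Data.Bool using (Bool; true; false; if_then_else_)
open import Data.Empty using (⊥-elim)
open import Data.Fin using (Fin; zero; suc; toℕ; combine; quotient; remainder; inject≤)
open import Data.Fin.Properties using (combine-injectiveˡ; combine-injectiveʳ; remQuot-combine; combine-remQuot; toℕ-inject≤)
import Data.Fin.Properties as Fin
open import Data.Nat using (ℕ; zero; suc; pred; NonZero; ≢-nonZero; _+_; _*_; _^_; _≤_; _<_; z≤n; s≤s; ⌊_/2⌋; ⌈_/2⌉; _<?_)
open import Data.Nat.Tactic.RingSolver using (solve-∀)
import Data.Nat.Properties as ℕ
open import Data.Nat.Logarithm using (⌈log₂_⌉; ⌈log₂⌉-mono-≤; ⌈log₂2^n⌉≡n)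
open import Data.Nat.Logarithm.Core using (⌈log2⌉)
open import Data.Product using (_×_; _,_; proj₁; proj₂)
open import Data.Sum using (_⊎_; inj₁; inj₂)
open import Induction.WellFounded using (Acc; acc)
open import Relation.Nullary using (¬_; Dec; yes; no; does; proof; ¬?)
open import Relation.Nullary.Reflects using (Reflects; ofʸ; ofⁿ)
open import Relation.Nullary.Decidable using (_×-dec_; _⊎-dec_; decidable-stable)
open import Relation.Binary.PropositionalEquality

module _ {Q : Set} {A : Q → Set} where

  query : (q : Q) → DT Q A (A q)
  query q = node q leaf

  _>>=_ : {X Y : Set} → DT Q A X → (X → DT Q A Y) → DT Q A Y
  leaf x   >>= k = k x
  node q t >>= k = node q (λ a → t a >>= k)

  eval->>= : {X Y : Set} (t : DT Q A X) (k : X → DT Q A Y) (I : (q : Q) → A q) →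
             eval (t >>= k) I ≡ eval (k (eval t I)) I
  eval->>= (leaf x)   k I = refl
  eval->>= (node q t) k I = eval->>= (t (I q)) k I

  DepthLE-weaken : {O : Set} {t : DT Q A O} {d e : ℕ} → d ≤ e → DepthLE t d → DepthLE t e
  DepthLE-weaken _         leaf≤      = leaf≤
  DepthLE-weaken (s≤s d≤e) (node≤ ts) = node≤ λ a → DepthLE-weaken d≤e (ts a)

  DepthLE->>= : {X Y : Set} {t : DT Q A X} {k : X → DT Q A Y} {d e : ℕ} →
                DepthLE t d → (∀ x → DepthLE (k x) e) → DepthLE (t >>= k) (d + e)
  DepthLE->>= {d = d} leaf≤      ks = DepthLE-weaken (ℕ.m≤n+m _ d) (ks _)
  DepthLE->>=         (node≤ ts) ks = node≤ λ a → DepthLE->>= (ts a) ks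

  orElse : {O : Set} → O → DT Q A Bool → DT Q A O → DT Q A O
  orElse o check rest = check >>= λ b → if b then leaf o else rest

  DepthLE-orElse : {O : Set} {o : O} {check : DT Q A Bool} {rest : DT Q A O} {d e : ℕ} →
                   DepthLE check d → DepthLE rest e → DepthLE (orElse o check rest) (d + e)
  DepthLE-orElse c r = DepthLE->>= c λ { true → leaf≤ ; false → r }

  orElse-sound : {O : Set} (Sol : O → Set) (o : O) (check : DT Q A Bool) (rest : DT Q A O)
                 (I : (q : Q) → A q) → Reflects (Sol o) (eval check I) →
                 (¬ Sol o → Sol (eval rest I)) → Sol (eval (orElse o check rest) I)
  orElse-sound Sol o check rest I r k
    rewrite eval->>= check (λ b → if b then leaf o else rest) I with eval check I | r
  ... | true  | ofʸ s  = s
  ... | false | ofⁿ ¬s = k ¬s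

Source : ℕ → ℕ → Set → Set
Source n m = DT (LSQuery n m) (LSAns (n , m))

-- SOMLSol m S P W z as a function of the nine values of S, P and W it inspects, so that a
-- decision tree can decide it after querying them.
SOMLSol-local? : ∀ {m} (z s₁ p₁ : Fin (suc m)) (w₁ : Fin (suc (suc m)))
                 (sz psz : Fin (suc m)) (wz wsz : Fin (suc (suc m)))
                 (pz : Fin (suc m)) (wpz : Fin (suc (suc m))) →
                 Dec ((z ≡ zero × (p₁ ≢ zero ⊎ s₁ ≡ zero ⊎ toℕ w₁ ≢ 1))
                     ⊎ psz ≢ z
                     ⊎ (z ≢ zero × toℕ wz ≡ 1)
                     ⊎ ((0 < toℕ wz × toℕ wsz ≢ suc (toℕ wz))
                        ⊎ (1 < toℕ wz × toℕ wz ≢ suc (toℕ wpz))))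
SOMLSol-local? z s₁ p₁ w₁ sz psz wz wsz pz wpz =
      ((z Fin.≟ zero) ×-dec (¬? (p₁ Fin.≟ zero) ⊎-dec (s₁ Fin.≟ zero) ⊎-dec ¬? (toℕ w₁ ℕ.≟ 1)))
  ⊎-dec ¬? (psz Fin.≟ z)
  ⊎-dec (¬? (z Fin.≟ zero) ×-dec (toℕ wz ℕ.≟ 1))
  ⊎-dec (((0 <? toℕ wz) ×-dec ¬? (toℕ wsz ℕ.≟ suc (toℕ wz)))
         ⊎-dec ((1 <? toℕ wz) ×-dec ¬? (toℕ wz ℕ.≟ suc (toℕ wpz))))

meteredLineCheck : ∀ {n m} → Fin (suc m) → Source n m Bool
meteredLineCheck z = do
  s₁  ← query (qS zero)
  p₁  ← query (qP zero)
  w₁  ← query (qW zero)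
  sz  ← query (qS z)
  psz ← query (qP sz)
  wz  ← query (qW z)
  wsz ← query (qW sz)
  pz  ← query (qP z)
  wpz ← query (qW pz)
  leaf (does (SOMLSol-local? z s₁ p₁ w₁ sz psz wz wsz pz wpz))

meteredLineCheck-reflects : ∀ {n m} (z : Fin (suc m)) I →
  Reflects (LSSol (n , m) I (inj₂ z)) (eval (meteredLineCheck z) I)
meteredLineCheck-reflects z I = proof (SOMLSol-local? z (I (qS zero)) (I (qP zero)) (I (qW zero))
  (I (qS z)) (I (qP (I (qS z)))) (I (qW z)) (I (qW (I (qS z)))) (I (qP z)) (I (qW (I (qP z)))))

DepthLE-meteredLineCheck : ∀ {n m} (z : Fin (suc m)) → DepthLE (meteredLineCheck {n} z) 9
DepthLE-meteredLineCheck z =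
  node≤ λ _ → node≤ λ _ → node≤ λ _ → node≤ λ _ → node≤ λ _ →
  node≤ λ _ → node≤ λ _ → node≤ λ _ → node≤ λ _ → leaf≤

lossyCodeCheck : ∀ {n m} → Fin (2 * suc n) → Source n m Bool
lossyCodeCheck c = do
  gc  ← query (qg c)
  fgc ← query (qf gc)
  leaf (does (¬? (fgc Fin.≟ c)))

lossyCodeCheck-reflects : ∀ {n m} (c : Fin (2 * suc n)) I →
  Reflects (LSSol (n , m) I (inj₁ c)) (eval (lossyCodeCheck c) I)
lossyCodeCheck-reflects c I = proof (¬? (I (qf (I (qg c))) Fin.≟ c))

DepthLE-lossyCodeCheck : ∀ {n m} (c : Fin (2 * suc n)) → DepthLE (lossyCodeCheck {n} {m} c) 2
DepthLE-lossyCodeCheck c = node≤ λ _ → node≤ λ _ → leaf≤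

module MeteredLine {m : ℕ} (S P : Fin (suc m) → Fin (suc m)) (W : Fin (suc m) → Fin (suc (suc m))) where

  private
    NoSink : Fin (suc m) → Set
    NoSink x = ¬ SOMLSol m S P W x

  P-zero≡zero : NoSink zero → P zero ≡ zero
  P-zero≡zero ¬sol = decidable-stable (P zero Fin.≟ zero) λ ne → ¬sol (inj₁ (refl , inj₁ ne))

  S-zero≢zero : NoSink zero → S zero ≢ zero
  S-zero≢zero ¬sol e = ¬sol (inj₁ (refl , inj₂ (inj₁ e)))

  W-zero≡1 : NoSink zero → toℕ (W zero) ≡ 1
  W-zero≡1 ¬sol = decidable-stable (toℕ (W zero) ℕ.≟ 1) λ ne → ¬sol (inj₁ (refl , inj₂ (inj₂ ne)))

  P∘S≡id : ∀ {x} → NoSink x → P (S x) ≡ x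
  P∘S≡id {x} ¬sol = decidable-stable (P (S x) Fin.≟ x) λ ne → ¬sol (inj₂ (inj₁ ne))

  W≢1 : ∀ {x} → NoSink x → x ≢ zero → toℕ (W x) ≢ 1
  W≢1 ¬sol x≢0 w≡1 = ¬sol (inj₂ (inj₂ (inj₁ (x≢0 , w≡1))))

  W∘S≡1+W : ∀ {x} → NoSink x → 0 < toℕ (W x) → toℕ (W (S x)) ≡ suc (toℕ (W x))
  W∘S≡1+W {x} ¬sol 0<w = decidable-stable (toℕ (W (S x)) ℕ.≟ suc (toℕ (W x)))
    λ ne → ¬sol (inj₂ (inj₂ (inj₂ (inj₁ (0<w , ne)))))

  W≡1+W∘P : ∀ {x} → NoSink x → 1 < toℕ (W x) → toℕ (W x) ≡ suc (toℕ (W (P x)))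
  W≡1+W∘P {x} ¬sol 1<w = decidable-stable (toℕ (W x) ℕ.≟ suc (toℕ (W (P x))))
    λ ne → ¬sol (inj₂ (inj₂ (inj₂ (inj₂ (1<w , ne)))))

  S≢zero : ∀ {x} → NoSink zero → NoSink x → S x ≢ zero
  S≢zero {x} ¬sol₀ ¬solₓ Sx≡0 = S-zero≢zero ¬sol₀ (subst (λ v → S v ≡ zero) x≡0 Sx≡0)
    where
    x≡0 : x ≡ zero
    x≡0 = trans (sym (P∘S≡id ¬solₓ)) (trans (cong P Sx≡0) (P-zero≡zero ¬sol₀))

data Role : Set where
  root dormant live : Role

dormant? : (r : Role) → Dec (r ≡ dormant)
dormant? root    = no λ ()
dormant? dormant = yes refl
dormant? live    = no λ ()

module _ {X : Set} where

  parentIf : Role → X → X → X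
  parentIf root    u _ = u
  parentIf dormant u _ = u
  parentIf live    _ v = v

  childIf : Role → X → X → X
  childIf dormant u _ = u
  childIf root    _ v = v
  childIf live    _ v = v

  parentIf≢⇒live : ∀ r {u v} → parentIf r u v ≢ u → r ≡ live
  parentIf≢⇒live root    moved = ⊥-elim (moved refl)
  parentIf≢⇒live dormant moved = ⊥-elim (moved refl)
  parentIf≢⇒live live    _     = refl

  childIf-≢dormant : ∀ {r u v} → r ≢ dormant → childIf r u v ≡ v
  childIf-≢dormant {root}    _     = refl
  childIf-≢dormant {dormant} awake = ⊥-elim (awake refl)
  childIf-≢dormant {live}    _     = refl

role : ∀ {n m} → Fin (suc m) → Fin (suc n) → Fin (suc (suc m)) → Role
role zero    zero    _       = root
role zero    (suc _) _       = dormant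
role (suc _) _       zero    = dormant
role (suc _) _       (suc _) = live

role≡live : ∀ {n m} {x : Fin (suc m)} {y : Fin (suc n)} {w} → x ≢ zero → w ≢ zero → role x y w ≡ live
role≡live {x = zero}              x≢0 _   = ⊥-elim (x≢0 refl)
role≡live {x = suc _} {w = zero}  _   w≢0 = ⊥-elim (w≢0 refl)
role≡live {x = suc _} {w = suc _} _   _   = refl

role≡live⁻¹ : ∀ {n m} {x : Fin (suc m)} {y : Fin (suc n)} {w} → role x y w ≡ live → x ≢ zero × w ≢ zero
role≡live⁻¹ {x = zero}  {y = zero}  ()
role≡live⁻¹ {x = zero}  {y = suc _} ()
role≡live⁻¹ {x = suc _} {w = zero}  ()
role≡live⁻¹ {x = suc _} {w = suc _} _ = (λ ()) , (λ ())

role≢dormant⇒ : ∀ {n m} {x : Fin (suc m)} {y : Fin (suc n)} {w} → role x y w ≢ dormant → x ≡ zero ⊎ w ≢ zero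
role≢dormant⇒ {x = zero}              _     = inj₁ refl
role≢dormant⇒ {x = suc _} {w = zero}  awake = ⊥-elim (awake refl)
role≢dormant⇒ {x = suc _} {w = suc _} _     = inj₂ λ ()

codeword : ∀ {n} → Fin 2 → Fin (suc n) → Fin (2 * suc n)
codeword = combine

message : ∀ {n} → Fin (2 * suc n) → Fin (suc n)
message {n} = remainder {2} (suc n)

message-codeword : ∀ {n} j (y : Fin (suc n)) → message (codeword j y) ≡ y
message-codeword j y = cong proj₂ (remQuot-combine j y)

module Grid (n m : ℕ) where

  Node : Set
  Node = Fin (suc m * suc n)

  layer : Node → Fin (suc m)
  layer = quotient {suc m} (suc n)

  slot : Node → Fin (suc n)
  slot = remainder {suc m} (suc n)

  layer-combine : ∀ (x : Fin (suc m)) (y : Fin (suc n)) → layer (combine x y) ≡ x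
  layer-combine x y = cong proj₁ (remQuot-combine x y)

  slot-combine : ∀ (x : Fin (suc m)) (y : Fin (suc n)) → slot (combine x y) ≡ y
  slot-combine x y = cong proj₂ (remQuot-combine x y)

  combine-layer-slot : ∀ u → combine (layer u) (slot u) ≡ u
  combine-layer-slot = combine-remQuot {suc m} (suc n)

  code : Fin 2 → Node → Fin (2 * suc n)
  code j u = codeword j (slot u)

  -- W x is the height of the nodes on layer x; heights of Empty-Child-w-Height are stored minus one.
  heightOf : Fin (suc (suc m)) → Node
  heightOf zero    = zero
  heightOf (suc w) = inject≤ w (ℕ.m≤m*n (suc m) (suc n))

  toℕ-heightOf : ∀ w → toℕ (heightOf w) ≡ pred (toℕ w)
  toℕ-heightOf zero    = refl
  toℕ-heightOf (suc w) = toℕ-inject≤ w _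

  parentOf : Node → Fin (suc (suc m)) → Fin (2 * suc n) → Fin (suc m) → Node
  parentOf u w c p = parentIf (role (layer u) (slot u) w) u (combine p (message c))

  childOf : Node → Fin (suc (suc m)) → Fin (suc m) → Fin (suc n) → Node
  childOf u w s y = childIf (role (layer u) (slot u) w) u (combine s y)

  parentQuery : Node → Source n m Node
  parentQuery u = do
    w ← query (qW (layer u))
    c ← query (qf (slot u))
    p ← query (qP (layer u))
    leaf (parentOf u w c p)

  childQuery : Fin 2 → Node → Source n m Node
  childQuery j u = do
    w ← query (qW (layer u))
    s ← query (qS (layer u))
    y ← query (qg (code j u))
    leaf (childOf u w s y)

  heightQuery : Node → Source n m Node
  heightQuery u = do
    w ← query (qW (layer u))
    leaf (heightOf w)

module Target {n m : ℕ} (f : Fin (suc n) → Fin (2 * suc n)) (g : Fin (2 * suc n) → Fin (suc n))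
              (S P : Fin (suc m) → Fin (suc m)) (W : Fin (suc m) → Fin (suc (suc m))) where

  open Grid n m
  open MeteredLine S P W
  open ≡-Reasoning

  F H : Node → Node
  F u = parentOf u (W (layer u)) (f (slot u)) (P (layer u))
  H u = heightOf (W (layer u))

  child : Fin 2 → Node → Node
  child j u = childOf u (W (layer u)) (S (layer u)) (g (code j u))

  L R : Node → Node
  L = child zero
  R = child (suc zero)

  f∘g≡id : ∀ {c} → ¬ LossyCodeSol n f g c → f (g c) ≡ c
  f∘g≡id {c} = decidable-stable (f (g c) Fin.≟ c)

  F-live : ∀ {x} y → x ≢ zero → W x ≢ zero → F (combine x y) ≡ combine (P x) (message (f y))
  F-live {x} y x≢0 Wx≢0 = begin
    F (combine x y)
      ≡⟨ cong₂ (λ x′ y′ → parentIf (role x′ y′ (W x′)) (combine x y) (combine (P x′) (message (f y′))))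
               (layer-combine x y) (slot-combine x y) ⟩
    parentIf (role x y (W x)) (combine x y) (combine (P x) (message (f y)))
      ≡⟨ cong (λ r → parentIf r (combine x y) (combine (P x) (message (f y)))) (role≡live x≢0 Wx≢0) ⟩
    combine (P x) (message (f y)) ∎

  H-combine : ∀ x y → H (combine x y) ≡ heightOf (W x)
  H-combine x y = cong (λ x′ → heightOf (W x′)) (layer-combine x y)

  module _ (¬sol₀ : ¬ SOMLSol m S P W zero) where

    child-root≢root : ∀ j → child j zero ≢ zero
    child-root≢root j e = S-zero≢zero ¬sol₀ (combine-injectiveˡ (S zero) _ zero zero e)

    H-root : H zero ≡ zero
    H-root = Fin.toℕ-injective (trans (toℕ-heightOf (W zero)) (cong pred (W-zero≡1 ¬sol₀)))

    module _ (u : Node) (¬solᵤ : ¬ SOMLSol m S P W (layer u))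
             (f∘g≡idᵤ : ∀ j → f (g (code j u)) ≡ code j u) where

      private
        x : Fin (suc m)
        x = layer u
        y : Fin (suc n)
        y = slot u

      ≢dormant⇒0<W : role x y (W x) ≢ dormant → 0 < toℕ (W x)
      ≢dormant⇒0<W awake with role≢dormant⇒ awake
      ... | inj₁ x≡0 = subst (λ v → 0 < toℕ (W v)) (sym x≡0) (subst (0 <_) (sym (W-zero≡1 ¬sol₀)) (s≤s z≤n))
      ... | inj₂ w≢0 = ℕ.n≢0⇒n>0 λ e → w≢0 (Fin.toℕ-injective e)

      F∘child≡id : ∀ j → F (child j u) ≡ u
      F∘child≡id j with dormant? (role x y (W x))
      ... | yes asleep = begin
        F (child j u)  ≡⟨ cong F (cong (λ r → childIf r u _) asleep) ⟩
        F u            ≡⟨ cong (λ r → parentIf r u _) asleep ⟩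
        u              ∎
      ... | no awake = begin
        F (child j u)                             ≡⟨ cong F (childIf-≢dormant awake) ⟩
        F (combine (S x) (g c))                   ≡⟨ F-live (g c) (S≢zero ¬sol₀ ¬solᵤ) W∘S≢0 ⟩
        combine (P (S x)) (message (f (g c)))     ≡⟨ cong₂ combine (P∘S≡id ¬solᵤ) (cong message (f∘g≡idᵤ j)) ⟩
        combine x (message c)                     ≡⟨ cong (combine x) (message-codeword j y) ⟩
        combine x y                               ≡⟨ combine-layer-slot u ⟩
        u                                         ∎
        where
        c : Fin (2 * suc n)
        c = code j u
        W∘S≢0 : W (S x) ≢ zero
        W∘S≢0 e = ℕ.0≢1+n (trans (sym (cong toℕ e)) (W∘S≡1+W ¬solᵤ (≢dormant⇒0<W awake)))

      L≡R⇒L≡id : L u ≡ R u → L u ≡ u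
      L≡R⇒L≡id L≡R with dormant? (role x y (W x))
      ... | yes asleep = cong (λ r → childIf r u _) asleep
      ... | no awake = ⊥-elim (0≢1 (combine-injectiveˡ zero y (suc zero) y codes≡))
        where
        g≡ : g (code zero u) ≡ g (code (suc zero) u)
        g≡ = combine-injectiveʳ (S x) _ (S x) _ (trans (sym (childIf-≢dormant awake)) (trans L≡R (childIf-≢dormant awake)))
        codes≡ : code zero u ≡ code (suc zero) u
        codes≡ = trans (sym (f∘g≡idᵤ zero)) (trans (cong f g≡) (f∘g≡idᵤ (suc zero)))
        0≢1 : zero ≢ suc {1} zero
        0≢1 ()

      H≡1+H∘F : u ≢ F u → toℕ (H u) ≡ suc (toℕ (H (F u)))
      H≡1+H∘F u≢Fu = begin
        toℕ (H u)                                      ≡⟨ toℕ-heightOf (W x) ⟩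
        pred (toℕ (W x))                               ≡⟨ cong pred W≡1+W∘Pₓ ⟩
        toℕ (W (P x))                                  ≡⟨ ℕ.suc-pred _ {{≢-nonZero W∘P≢0}} ⟨
        suc (pred (toℕ (W (P x))))                     ≡⟨ cong suc (toℕ-heightOf (W (P x))) ⟨
        suc (toℕ (heightOf (W (P x))))                 ≡⟨ cong (λ v → suc (toℕ v)) (H-combine (P x) _) ⟨
        suc (toℕ (H (combine (P x) (message (f y)))))  ≡⟨ cong (λ v → suc (toℕ (H v))) F≡ ⟨
        suc (toℕ (H (F u)))                            ∎
        where
        isLive : role x y (W x) ≡ live
        isLive = parentIf≢⇒live _ λ e → u≢Fu (sym e)
        F≡ : F u ≡ combine (P x) (message (f y))
        F≡ = cong (λ r → parentIf r u _) isLive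
        W≢1ₓ : toℕ (W x) ≢ 1
        W≢1ₓ = W≢1 ¬solᵤ (proj₁ (role≡live⁻¹ isLive))
        1<W : 1 < toℕ (W x)
        1<W = ℕ.≤∧≢⇒< (ℕ.n≢0⇒n>0 λ e → proj₂ (role≡live⁻¹ isLive) (Fin.toℕ-injective e)) λ e → W≢1ₓ (sym e)
        W≡1+W∘Pₓ : toℕ (W x) ≡ suc (toℕ (W (P x)))
        W≡1+W∘Pₓ = W≡1+W∘P ¬solᵤ 1<W
        W∘P≢0 : toℕ (W (P x)) ≢ 0
        W∘P≢0 e = W≢1ₓ (trans W≡1+W∘Pₓ (cong suc e))

      noSolution : ¬ ECHSol (n + m * suc n) F L R H u
      noSolution (inj₁ (inj₁ F∘L≢id))                      = F∘L≢id (F∘child≡id zero)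
      noSolution (inj₁ (inj₂ (inj₁ F∘R≢id)))               = F∘R≢id (F∘child≡id (suc zero))
      noSolution (inj₁ (inj₂ (inj₂ (L≡R , L≢id))))         = L≢id (L≡R⇒L≡id L≡R)
      noSolution (inj₂ (inj₁ (refl , inj₁ L≡root)))        = child-root≢root zero L≡root
      noSolution (inj₂ (inj₁ (refl , inj₂ (inj₁ R≡root)))) = child-root≢root (suc zero) R≡root
      noSolution (inj₂ (inj₁ (refl , inj₂ (inj₂ F≢root)))) = F≢root refl
      noSolution (inj₂ (inj₂ (inj₁ (_ , u≢F , H≢))))       = H≢ (H≡1+H∘F u≢F)
      noSolution (inj₂ (inj₂ (inj₂ (refl , H≢0))))         = H≢0 H-root

n≤2*⌈n/2⌉ : ∀ n → n ≤ 2 * ⌈ n /2⌉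
n≤2*⌈n/2⌉ n = begin
  n                        ≡⟨ ℕ.⌊n/2⌋+⌈n/2⌉≡n n ⟨
  ⌊ n /2⌋ + ⌈ n /2⌉        ≤⟨ ℕ.+-monoˡ-≤ ⌈ n /2⌉ (ℕ.⌊n/2⌋≤⌈n/2⌉ n) ⟩
  ⌈ n /2⌉ + ⌈ n /2⌉        ≡⟨ cong (⌈ n /2⌉ +_) (ℕ.+-identityʳ ⌈ n /2⌉) ⟨
  2 * ⌈ n /2⌉              ∎
  where open ℕ.≤-Reasoning

n≤2^⌈log2⌉n : ∀ n (rec : Acc _<_ n) → n ≤ 2 ^ ⌈log2⌉ n rec
n≤2^⌈log2⌉n zero          _        = z≤n
n≤2^⌈log2⌉n (suc zero)    _        = s≤s z≤n
n≤2^⌈log2⌉n (suc (suc n)) (acc rs) =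
  ℕ.≤-trans (n≤2*⌈n/2⌉ (suc (suc n))) (ℕ.*-monoʳ-≤ 2 (n≤2^⌈log2⌉n (suc ⌈ n /2⌉) _))

n≤2^⌈log₂n⌉ : ∀ n → n ≤ 2 ^ ⌈log₂ n ⌉
n≤2^⌈log₂n⌉ n = n≤2^⌈log2⌉n n _

⌈log₂[m*n]⌉≤⌈log₂m⌉+⌈log₂n⌉ : ∀ m n → ⌈log₂ (m * n) ⌉ ≤ ⌈log₂ m ⌉ + ⌈log₂ n ⌉
⌈log₂[m*n]⌉≤⌈log₂m⌉+⌈log₂n⌉ m n = begin
  ⌈log₂ (m * n) ⌉                           ≤⟨ ⌈log₂⌉-mono-≤ (ℕ.*-mono-≤ (n≤2^⌈log₂n⌉ m) (n≤2^⌈log₂n⌉ n)) ⟩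
  ⌈log₂ (2 ^ ⌈log₂ m ⌉ * 2 ^ ⌈log₂ n ⌉) ⌉   ≡⟨ cong ⌈log₂_⌉ (ℕ.^-distribˡ-+-* 2 ⌈log₂ m ⌉ ⌈log₂ n ⌉) ⟨
  ⌈log₂ (2 ^ (⌈log₂ m ⌉ + ⌈log₂ n ⌉)) ⌉     ≡⟨ ⌈log₂2^n⌉≡n _ ⟩
  ⌈log₂ m ⌉ + ⌈log₂ n ⌉                     ∎
  where open ℕ.≤-Reasoning

m*n≤m*n^k : ∀ m n k .{{_ : NonZero n}} .{{_ : NonZero k}} → m * n ≤ m * n ^ k
m*n≤m*n^k m n (suc k) = ℕ.*-monoʳ-≤ m (ℕ.m≤m*n n (n ^ k) {{ℕ.m^n≢0 n k}})

grid-log-bound : ∀ n m → ⌈log₂ (4 * (suc m * suc n)) ⌉ ≤ 2 + 2 * ⌈log₂ (3 * suc n + 3 * suc m) ⌉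
grid-log-bound n m = begin
  ⌈log₂ (4 * (M * N)) ⌉                ≤⟨ ⌈log₂[m*n]⌉≤⌈log₂m⌉+⌈log₂n⌉ 4 (M * N) ⟩
  ⌈log₂ (2 ^ 2) ⌉ + ⌈log₂ (M * N) ⌉    ≡⟨ cong (_+ ⌈log₂ (M * N) ⌉) (⌈log₂2^n⌉≡n 2) ⟩
  2 + ⌈log₂ (M * N) ⌉                  ≤⟨ ℕ.+-monoʳ-≤ 2 (⌈log₂[m*n]⌉≤⌈log₂m⌉+⌈log₂n⌉ M N) ⟩
  2 + (⌈log₂ M ⌉ + ⌈log₂ N ⌉)          ≤⟨ ℕ.+-monoʳ-≤ 2 (ℕ.+-mono-≤ (⌈log₂⌉-mono-≤ M≤s) (⌈log₂⌉-mono-≤ N≤s)) ⟩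
  2 + (ℓ + ℓ)                          ≡⟨ cong (λ k → 2 + (ℓ + k)) (ℕ.+-identityʳ ℓ) ⟨
  2 + 2 * ℓ                            ∎
  where
  open ℕ.≤-Reasoning
  M N s ℓ : ℕ
  M = suc m
  N = suc n
  s = 3 * N + 3 * M
  ℓ = ⌈log₂ s ⌉
  M≤s : M ≤ s
  M≤s = ℕ.≤-trans (ℕ.m≤n*m M 3) (ℕ.m≤n+m (3 * M) (3 * N))
  N≤s : N ≤ s
  N≤s = ℕ.≤-trans (ℕ.m≤n*m N 3) (ℕ.m≤m+n (3 * N) (3 * M))

affine≤poly : ∀ ℓ k → k ≤ 2 + 2 * ℓ → k + 22 ≤ 24 * suc ℓ ^ 24
affine≤poly ℓ k k≤ = begin
  k + 22                    ≤⟨ ℕ.+-monoˡ-≤ 22 k≤ ⟩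
  2 + 2 * ℓ + 22            ≤⟨ ℕ.m≤m+n (2 + 2 * ℓ + 22) (22 * ℓ) ⟩
  2 + 2 * ℓ + 22 + 22 * ℓ   ≡⟨ linear ℓ ⟩
  24 * suc ℓ                ≤⟨ m*n≤m*n^k 24 (suc ℓ) 24 ⟩
  24 * suc ℓ ^ 24           ∎
  where
  open ℕ.≤-Reasoning
  linear : ∀ ℓ → 2 + 2 * ℓ + 22 + 22 * ℓ ≡ 24 * suc ℓ
  linear = solve-∀

gridParam : ℕ × ℕ → ℕ
gridParam (n , m) = n + m * suc n

instanceQuery : ∀ p (q : ECQuery (gridParam p)) → Source (proj₁ p) (proj₂ p) (Fin (suc (gridParam p)))
instanceQuery (n , m) (qF u) = Grid.parentQuery n m u
instanceQuery (n , m) (qL u) = Grid.childQuery n m zero u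
instanceQuery (n , m) (qR u) = Grid.childQuery n m (suc zero) u
instanceQuery (n , m) (qH u) = Grid.heightQuery n m u

DepthLE-instanceQuery : ∀ p q → DepthLE (instanceQuery p q) 22
DepthLE-instanceQuery (n , m) (qF u) = node≤ λ _ → node≤ λ _ → node≤ λ _ → leaf≤
DepthLE-instanceQuery (n , m) (qL u) = node≤ λ _ → node≤ λ _ → node≤ λ _ → leaf≤
DepthLE-instanceQuery (n , m) (qR u) = node≤ λ _ → node≤ λ _ → node≤ λ _ → leaf≤
DepthLE-instanceQuery (n , m) (qH u) = node≤ λ _ → leaf≤

solutionQuery : ∀ p (u : Fin (suc (gridParam p))) →
                Source (proj₁ p) (proj₂ p) (Fin (2 * suc (proj₁ p)) ⊎ Fin (suc (proj₂ p)))
solutionQuery (n , m) u =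
  orElse (inj₂ zero) (meteredLineCheck zero)
    (orElse (inj₂ (layer u)) (meteredLineCheck (layer u))
      (orElse (inj₁ c₀) (lossyCodeCheck c₀)
        (orElse (inj₁ c₁) (lossyCodeCheck c₁)
          (leaf (inj₁ c₁)))))
  where
  open Grid n m
  c₀ c₁ : Fin (2 * suc n)
  c₀ = code zero u
  c₁ = code (suc zero) u

DepthLE-solutionQuery : ∀ p u → DepthLE (solutionQuery p u) 22
DepthLE-solutionQuery (n , m) u =
  DepthLE-orElse (DepthLE-meteredLineCheck _)
    (DepthLE-orElse (DepthLE-meteredLineCheck _)
      (DepthLE-orElse (DepthLE-lossyCodeCheck _)
        (DepthLE-orElse (DepthLE-lossyCodeCheck _) leaf≤)))

solutionQuery-correct : ∀ p I u →
  Sol EmptyChildWithHeight (gridParam p) (λ q → eval (instanceQuery p q) I) u →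
  Sol LossyCode∩SOML p I (eval (solutionQuery p u) I)
solutionQuery-correct (n , m) I u sol =
  orElse-sound Solᴵ (inj₂ zero) (meteredLineCheck zero) _ I (meteredLineCheck-reflects zero I) λ ¬sol₀ →
  orElse-sound Solᴵ (inj₂ x) (meteredLineCheck x) _ I (meteredLineCheck-reflects x I) λ ¬solᵤ →
  orElse-sound Solᴵ (inj₁ c₀) (lossyCodeCheck c₀) _ I (lossyCodeCheck-reflects c₀ I) λ ¬lossy₀ →
  orElse-sound Solᴵ (inj₁ c₁) (lossyCodeCheck c₁) _ I (lossyCodeCheck-reflects c₁ I) λ ¬lossy₁ →
  ⊥-elim (noSolution ¬sol₀ u ¬solᵤ (λ { zero → f∘g≡id ¬lossy₀ ; (suc zero) → f∘g≡id ¬lossy₁ }) sol)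
  where
  open Grid n m
  open Target (λ i → I (qf i)) (λ j → I (qg j)) (λ i → I (qS i)) (λ i → I (qP i)) (λ i → I (qW i))
  Solᴵ : Fin (2 * suc n) ⊎ Fin (suc m) → Set
  Solᴵ = LSSol (n , m) I
  x : Fin (suc m)
  x = layer u
  c₀ c₁ : Fin (2 * suc n)
  c₀ = code zero u
  c₁ = code (suc zero) u

size-bound : ∀ p → ⌈log₂ size EmptyChildWithHeight (gridParam p) ⌉ + 22 ≤ 24 * suc ⌈log₂ size LossyCode∩SOML p ⌉ ^ 24
size-bound (n , m) = affine≤poly ⌈log₂ size LossyCode∩SOML (n , m) ⌉ ⌈log₂ size EmptyChildWithHeight (gridParam (n , m)) ⌉
                                 (grid-log-bound n m)

theorem5p6 : LossyCode∩SOML ≤dt EmptyChildWithHeight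
theorem5p6 = record
  { tgt        = gridParam
  ; depth      = λ _ → 22
  ; inst       = instanceQuery
  ; inst-depth = DepthLE-instanceQuery
  ; back       = solutionQuery
  ; back-depth = DepthLE-solutionQuery
  ; correct    = solutionQuery-correct
  ; polylog    = 24 , size-bound
  }
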